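{- Let $C_n$ be the cycle of length $n\geq 3$. Then $\chi_i^{c}(C_n)=4$ if $n$ is even, $\chi_i^{c}(C_n)=5$ if $n\geq 5$ is odd, and $\chi_i^{c}(C_3)=6$.
   Context: An incidence of a graph $G$ is a pair $(v,e)$ where $v$ is a vertex and $e$ an edge incident with $v$. For a vertex $w$, let $I(w)$ be the set of all incidences $(u,e)$ such that $e$ is incident with $w$. Two incidences conflict if both lie in $I(w)$ for some vertex $w$. A conflict-free incidence $k$-coloring assigns colors from a $k$-element set to the incidences so that conflicting incidences get distinct colors; $\chi^{c}_i(G)$ is the least such $k$. -}

module Defs where

open import Data.Nat using (ℕ; zero; suc; _≤_; _%_)
open import Data.Fin using (Fin; toℕ)
open import Data.Empty using (⊥)
open import Data.Sum using (_⊎_)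
open import Data.Product using (_×_; Σ; ∃; _,_)
open import Relation.Binary.PropositionalEquality using (_≡_; _≢_)
open import Relation.Nullary using (¬_)

-- A finite simple graph on vertex set Fin n, given by its adjacency relation
-- (assumed symmetric and irreflexive; the edge {v,u} is determined by v and u).
record Graph : Set₁ where
  field
    size : ℕ
    Adj  : Fin size → Fin size → Set
open Graph public

-- An incidence (v, e) with e = {v,u} is encoded as the ordered pair (v , u)
-- with Adj v u.
Incidence : Graph → Set
Incidence G = Σ (Fin (size G) × Fin (size G)) λ { (v , u) → Adj G v u }

-- The incidence (v , u) (vertex v, edge vu) lies in I(w) iff the edge vu is
-- incident with w, i.e. w ≡ v or w ≡ u.
InI : (G : Graph) → Fin (size G) → Incidence G → Set
InI G w ((v , u) , _) = (w ≡ v) ⊎ (w ≡ u)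

Conflict : (G : Graph) → Incidence G → Incidence G → Set
Conflict G i@((v , u) , _) j@((v' , u') , _) =
  ((v , u) ≢ (v' , u')) × ∃ λ w → InI G w i × InI G w j

IsCFIncColoring : (G : Graph) (k : ℕ) → (Incidence G → Fin k) → Set
IsCFIncColoring G k c = ∀ i j → Conflict G i j → c i ≢ c j

CFIncColorable : Graph → ℕ → Set
CFIncColorable G k = Σ (Incidence G → Fin k) (IsCFIncColoring G k)

ChiIc≡ : Graph → ℕ → Set
ChiIc≡ G m = CFIncColorable G m × (∀ k → CFIncColorable G k → m ≤ k)

CycleAdj : (n : ℕ) → Fin n → Fin n → Set
CycleAdj zero    i j = ⊥
CycleAdj (suc m) i j =
  (toℕ j ≡ suc (toℕ i) % suc m) ⊎ (toℕ i ≡ suc (toℕ j) % suc m)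

Cycle : ℕ → Graph
Cycle n = record { size = n ; Adj = CycleAdj n }

-- A conflict in C_n only occurs between incidences whose edges share a vertex, i.e. lie on the
-- same or on consecutive edges.  So a conflict-free colouring of C_n (n ≥ 3) amounts to giving
-- every edge an ordered pair of distinct colours (one per incidence) such that consecutive edges
-- get disjoint pairs.  Two consecutive edges already need 4 colours.  With exactly 4 colours the
-- pair of an edge is the complement of the pair of the next edge, so pairs repeat with period 2
-- and n must be even; in C_3 all three edges are pairwise consecutive, forcing 6 colours.
-- Conversely, {0,1} {2,3} alternating colours an even cycle, and for odd n ≥ 5 the pattern
-- {0,1} {2,3} … {0,1} {2,3} {4,0} {1,2} {3,4} uses 5 colours.

module Submission where

open import Defs
open import Data.Nat using (ℕ; zero; suc; _+_; NonZero; _≤_; _<_; _*_; _%_; s≤s)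
open import Data.Nat.Properties using (suc-injective; 1+n≢n; <⇒≢; n≤1+n; ≤∧≢⇒<; n≮n)
  renaming (_≟_ to _≟ℕ_)
open import Data.Nat.DivMod using (m%n<n; m<n⇒m%n≡m; n%n≡0; %-distribˡ-+; m%n%n≡m%n)
open import Data.Nat.Divisibility using (_∣_; divides; _∣0; ∣-refl; ∣m∣n⇒∣m+n)
open import Data.Nat.GeneralisedArithmetic using (fold)
open import Data.Fin as Fin using (Fin; toℕ; fromℕ<; #_)
open import Data.Fin.Properties using (toℕ-fromℕ<; toℕ-injective; toℕ≤pred[n]; injective⇒≤)
open import Data.Bool using (Bool; true; false)
open import Data.Empty using (⊥)
open import Data.Sum using (_⊎_; inj₁; inj₂)
open import Data.Product using (Σ; ∃-syntax; _×_; _,_; proj₁; proj₂)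
open import Data.List using (List; []; _∷_; _++_; length; lookup)
open import Data.List.Membership.Propositional using (_∈_)
open import Data.List.Membership.Propositional.Properties using (∈-lookup; ∈-++⁻)
open import Data.List.Relation.Unary.Any using (here; there; any?)
open import Data.List.Relation.Unary.All as All using ([]; _∷_)
open import Data.List.Relation.Unary.All.Properties using (¬Any⇒All¬)
open import Data.List.Relation.Unary.AllPairs using ([]; _∷_)
open import Data.List.Relation.Unary.Unique.Propositional using (Unique)
open import Data.List.Relation.Unary.Unique.Propositional.Properties using (++⁺; concat⁺)
open import Data.List.Relation.Binary.Disjoint.Propositional using (Disjoint)
open import Data.List.Relation.Binary.Disjoint.Propositional.Properties using () renaming (sym to Disjoint-sym)
open import Function using (_∘_)
open import Function.Definitions using (Injective)
open import Relation.Binary.PropositionalEquality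
open import Relation.Nullary using (¬_; yes; no; contradiction)

private variable
  A : Set
  m k : ℕ

lookup-injective : {xs : List A} → Unique xs → Injective _≡_ _≡_ (lookup xs)
lookup-injective (_ ∷ _)      {Fin.zero}  {Fin.zero}  _  = refl
lookup-injective (x≢xs ∷ _)   {Fin.zero}  {Fin.suc j} eq = contradiction eq (All.lookup x≢xs (∈-lookup j))
lookup-injective (x≢xs ∷ _)   {Fin.suc i} {Fin.zero}  eq = contradiction (sym eq) (All.lookup x≢xs (∈-lookup i))
lookup-injective (_ ∷ unique) {Fin.suc i} {Fin.suc j} eq = cong Fin.suc (lookup-injective unique eq)

unique⇒length≤ : {xs : List (Fin k)} → Unique xs → length xs ≤ k
unique⇒length≤ unique = injective⇒≤ (lookup-injective unique)

unique∧length≡⇒∈ : {xs : List (Fin k)} → Unique xs → length xs ≡ k → ∀ x → x ∈ xs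
unique∧length≡⇒∈ {xs = xs} unique |xs|≡k x with any? (x Fin.≟_) xs
... | yes x∈xs = x∈xs
... | no  x∉xs = contradiction (subst (suc (length xs) ≤_) (sym |xs|≡k)
                   (unique⇒length≤ {xs = x ∷ xs} (¬Any⇒All¬ xs x∉xs ∷ unique))) (n≮n (length xs))

disjoint⇒≢ : {xs ys : List A} {x y : A} → Disjoint xs ys → x ∈ xs → y ∈ ys → x ≢ y
disjoint⇒≢ xs#ys x∈xs y∈ys refl = xs#ys (x∈xs , y∈ys)

[1+m%n]%n≡[1+m]%n : ∀ m n .{{_ : NonZero n}} → suc (m % n) % n ≡ suc m % n
[1+m%n]%n≡[1+m]%n m n = begin
  (1 + m % n) % n           ≡⟨ %-distribˡ-+ 1 (m % n) n ⟩
  (1 % n + m % n % n) % n   ≡⟨ cong (λ r → (1 % n + r) % n) (m%n%n≡m%n m n) ⟩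
  (1 % n + m % n) % n       ≡⟨ %-distribˡ-+ 1 m n ⟨
  (1 + m) % n               ∎
  where open ≡-Reasoning

next : Fin (suc m) → Fin (suc m)
next {m} i = fromℕ< (m%n<n (suc (toℕ i)) (suc m))

toℕ-next : (i : Fin (suc m)) → toℕ (next i) ≡ suc (toℕ i) % suc m
toℕ-next i = toℕ-fromℕ< _

NextCases : Fin (suc m) → Set
NextCases {m} i = (toℕ i < m × toℕ (next i) ≡ suc (toℕ i)) ⊎ (toℕ i ≡ m × toℕ (next i) ≡ 0)

toℕ-next-cases : (i : Fin (suc m)) → NextCases i
toℕ-next-cases {m} i with toℕ i ≟ℕ m
... | yes i≡m = inj₂ (i≡m , trans (toℕ-next i) (trans (cong (λ t → suc t % suc m) i≡m) (n%n≡0 (suc m))))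
... | no  i≢m = inj₁ (i<m , trans (toℕ-next i) (m<n⇒m%n≡m (s≤s i<m)))
  where
  i<m : toℕ i < m
  i<m = ≤∧≢⇒< (toℕ≤pred[n] i) i≢m

next-injective : {i j : Fin (suc m)} → next i ≡ next j → i ≡ j
next-injective {i = i} {j} ni≡nj = toℕ-injective (from-cases (toℕ-next-cases i) (toℕ-next-cases j))
  where
  ni≡nj′ : toℕ (next i) ≡ toℕ (next j)
  ni≡nj′ = cong toℕ ni≡nj
  from-cases : NextCases i → NextCases j → toℕ i ≡ toℕ j
  from-cases (inj₁ (_ , a))   (inj₁ (_ , b))   = suc-injective (trans (sym a) (trans ni≡nj′ b))
  from-cases (inj₁ (_ , a))   (inj₂ (_ , b))   = contradiction (trans (sym a) (trans ni≡nj′ b)) λ ()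
  from-cases (inj₂ (_ , a))   (inj₁ (_ , b))   = contradiction (trans (sym b) (trans (sym ni≡nj′) a)) λ ()
  from-cases (inj₂ (i≡m , _)) (inj₂ (j≡m , _)) = trans i≡m (sym j≡m)

next-irreflexive : (i : Fin (suc (suc m))) → next i ≢ i
next-irreflexive i ni≡i with toℕ-next-cases i
... | inj₁ (_ , ni≡1+i)  = 1+n≢n (trans (sym ni≡1+i) (cong toℕ ni≡i))
... | inj₂ (i≡m , ni≡0) = contradiction (trans (sym ni≡0) (trans (cong toℕ ni≡i) i≡m)) λ ()

next²-irreflexive : (i : Fin (suc (suc (suc m)))) → next (next i) ≢ i
next²-irreflexive i nni≡i = from-cases (toℕ-next-cases i) (toℕ-next-cases (next i))
  where
  nni≡i′ : toℕ (next (next i)) ≡ toℕ i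
  nni≡i′ = cong toℕ nni≡i
  from-cases : NextCases i → NextCases (next i) → ⊥
  from-cases (inj₁ (_ , a)) (inj₁ (_ , b)) =
    <⇒≢ (n≤1+n (suc (toℕ i))) (trans (sym nni≡i′) (trans b (cong suc a)))
  from-cases (inj₁ (_ , a)) (inj₂ (ni≡m , b)) =
    contradiction (trans (sym (cong suc (trans (sym nni≡i′) b))) (trans (sym a) ni≡m)) λ ()
  from-cases (inj₂ (i≡m , a)) (inj₁ (_ , b)) =
    contradiction (trans (sym (trans (sym nni≡i′) (trans b (cong suc a)))) i≡m) λ ()
  from-cases (inj₂ (_ , a)) (inj₂ (ni≡m , _)) = contradiction (trans (sym a) ni≡m) λ ()

toℕ-fold-next : ∀ j → toℕ (fold (Fin.zero {m}) next j) ≡ j % suc m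
toℕ-fold-next         zero    = refl
toℕ-fold-next {m = m} (suc j) = begin
  toℕ (next (fold (Fin.zero {m}) next j))        ≡⟨ toℕ-next _ ⟩
  suc (toℕ (fold (Fin.zero {m}) next j)) % suc m ≡⟨ cong (λ t → suc t % suc m) (toℕ-fold-next j) ⟩
  suc (j % suc m) % suc m                        ≡⟨ [1+m%n]%n≡[1+m]%n j (suc m) ⟩
  suc j % suc m                                  ∎
  where open ≡-Reasoning

fold-next-period : fold (Fin.zero {m}) next (suc m) ≡ Fin.zero {m}
fold-next-period {m} = toℕ-injective (trans (toℕ-fold-next (suc m)) (n%n≡0 (suc m)))

adjacent⇒next : {i j : Fin (suc m)} → toℕ j ≡ suc (toℕ i) % suc m → j ≡ next i
adjacent⇒next {i = i} j≡ = toℕ-injective (trans j≡ (sym (toℕ-next i)))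

-- The incidences of C_n are (e , e+1) and (e+1 , e), for the edge e = {e , e+1}.
edge : Incidence (Cycle (suc m)) → Fin (suc m)
edge ((v , _) , inj₁ _) = v
edge ((_ , u) , inj₂ _) = u

isForward : Incidence (Cycle (suc m)) → Bool
isForward (_ , inj₁ _) = true
isForward (_ , inj₂ _) = false

ends : Fin (suc m) → Bool → Fin (suc m) × Fin (suc m)
ends e true  = e , next e
ends e false = next e , e

ends-edge : (i : Incidence (Cycle (suc m))) → proj₁ i ≡ ends (edge i) (isForward i)
ends-edge ((v , _) , inj₁ u≡) = cong (v ,_) (adjacent⇒next u≡)
ends-edge ((_ , u) , inj₂ v≡) = cong (_, u) (adjacent⇒next v≡)

InI⇒endpoint : ∀ {w} (i : Incidence (Cycle (suc m))) → InI (Cycle (suc m)) w i →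
               w ≡ edge i ⊎ w ≡ next (edge i)
InI⇒endpoint ((_ , _) , inj₁ u≡) (inj₁ w≡v) = inj₁ w≡v
InI⇒endpoint ((_ , _) , inj₁ u≡) (inj₂ w≡u) = inj₂ (trans w≡u (adjacent⇒next u≡))
InI⇒endpoint ((_ , _) , inj₂ v≡) (inj₁ w≡v) = inj₂ (trans w≡v (adjacent⇒next v≡))
InI⇒endpoint ((_ , _) , inj₂ v≡) (inj₂ w≡u) = inj₁ w≡u

forward backward : Fin (suc m) → Incidence (Cycle (suc m))
forward  e = (e , next e) , inj₁ (toℕ-next e)
backward e = (next e , e) , inj₂ (toℕ-next e)

shared-endpoint⇒consecutive : {e e′ w : Fin (suc m)} → e ≢ e′ →
  w ≡ e ⊎ w ≡ next e → w ≡ e′ ⊎ w ≡ next e′ → e′ ≡ next e ⊎ e ≡ next e′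
shared-endpoint⇒consecutive e≢e′ (inj₁ w≡e)  (inj₁ w≡e′)  = contradiction (trans (sym w≡e) w≡e′) e≢e′
shared-endpoint⇒consecutive e≢e′ (inj₁ w≡e)  (inj₂ w≡ne′) = inj₂ (trans (sym w≡e) w≡ne′)
shared-endpoint⇒consecutive e≢e′ (inj₂ w≡ne) (inj₁ w≡e′)  = inj₁ (trans (sym w≡e′) w≡ne)
shared-endpoint⇒consecutive e≢e′ (inj₂ w≡ne) (inj₂ w≡ne′) =
  contradiction (next-injective (trans (sym w≡ne) w≡ne′)) e≢e′

colours : Fin k × Fin k → List (Fin k)
colours (a , b) = a ∷ b ∷ []

pick : Fin k × Fin k → Bool → Fin k
pick (a , _) true  = a
pick (_ , b) false = b

pick∈colours : (P : Fin k × Fin k) (d : Bool) → pick P d ∈ colours P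
pick∈colours _ true  = here refl
pick∈colours _ false = there (here refl)

colours-unique : {a b : Fin k} → a ≢ b → Unique (colours (a , b))
colours-unique a≢b = (a≢b ∷ []) ∷ [] ∷ []

pick-injective : {P : Fin k × Fin k} → Unique (colours P) → ∀ {d d′} → pick P d ≡ pick P d′ → d ≡ d′
pick-injective _                      {true}  {true}  _  = refl
pick-injective ((a≢b ∷ []) ∷ [] ∷ []) {true}  {false} eq = contradiction eq a≢b
pick-injective ((a≢b ∷ []) ∷ [] ∷ []) {false} {true}  eq = contradiction (sym eq) a≢b
pick-injective _                      {false} {false} _  = refl

colours-disjoint : {a b c d : Fin k} → a ≢ c → a ≢ d → b ≢ c → b ≢ d →
                   Disjoint (colours (a , b)) (colours (c , d))
colours-disjoint a≢c _   _   _   (here refl         , here refl)         = a≢c refl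
colours-disjoint _   a≢d _   _   (here refl         , there (here refl)) = a≢d refl
colours-disjoint _   _   b≢c _   (there (here refl) , here refl)         = b≢c refl
colours-disjoint _   _   _   b≢d (there (here refl) , there (here refl)) = b≢d refl

-- S e = (colour of (e , e+1) , colour of (e+1 , e)) for the edge e = {e , e+1}.
record IsCyclicPairing (S : Fin (suc m) → Fin k × Fin k) : Set where
  field
    unique   : ∀ e → Unique (colours (S e))
    disjoint : ∀ e → Disjoint (colours (S e)) (colours (S (next e)))

module _ {S : Fin (suc m) → Fin k × Fin k} (pairing : IsCyclicPairing S) where
  open IsCyclicPairing pairing

  pairingColour : Incidence (Cycle (suc m)) → Fin k
  pairingColour i = pick (S (edge i)) (isForward i)

  pairingColour∈ : ∀ i → pairingColour i ∈ colours (S (edge i))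
  pairingColour∈ i = pick∈colours (S (edge i)) (isForward i)

  pairingColour-isCFIncColoring : IsCFIncColoring (Cycle (suc m)) k pairingColour
  pairingColour-isCFIncColoring i j (i≢j , w , w∈i , w∈j) ci≡cj with edge i Fin.≟ edge j
  ... | yes e≡e′ = i≢j (begin
    proj₁ i                             ≡⟨ ends-edge i ⟩
    ends (edge i) (isForward i)         ≡⟨ cong₂ ends e≡e′ (pick-injective (unique (edge j)) ci≡cj′) ⟩
    ends (edge j) (isForward j)         ≡⟨ ends-edge j ⟨
    proj₁ j                             ∎)
    where
    open ≡-Reasoning
    ci≡cj′ : pick (S (edge j)) (isForward i) ≡ pick (S (edge j)) (isForward j)
    ci≡cj′ = trans (cong (λ e → pick (S e) (isForward i)) (sym e≡e′)) ci≡cj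
  ... | no e≢e′ with shared-endpoint⇒consecutive e≢e′ (InI⇒endpoint i w∈i) (InI⇒endpoint j w∈j)
  ...   | inj₁ e′≡ne = disjoint⇒≢ (disjoint (edge i)) (pairingColour∈ i)
                         (subst (λ e → pairingColour j ∈ colours (S e)) e′≡ne (pairingColour∈ j)) ci≡cj
  ...   | inj₂ e≡ne′ = disjoint⇒≢ (disjoint (edge j)) (pairingColour∈ j)
                         (subst (λ e → pairingColour i ∈ colours (S e)) e≡ne′ (pairingColour∈ i)) (sym ci≡cj)

  pairing⇒colourable : CFIncColorable (Cycle (suc m)) k
  pairing⇒colourable = pairingColour , pairingColour-isCFIncColoring

module _ {c : Incidence (Cycle (suc (suc (suc m)))) → Fin k}
         (c-isCF : IsCFIncColoring (Cycle (suc (suc (suc m)))) k c) where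

  incidencePairs : Fin (suc (suc (suc m))) → Fin k × Fin k
  incidencePairs e = c (forward e) , c (backward e)

  incidencePairs-isCyclicPairing : IsCyclicPairing incidencePairs
  incidencePairs-isCyclicPairing = record { unique = unique ; disjoint = disjoint }
    where
    e≢ne : ∀ e → e ≢ next e
    e≢ne e = next-irreflexive e ∘ sym

    e≢nne : ∀ e → e ≢ next (next e)
    e≢nne e = next²-irreflexive e ∘ sym

    unique : ∀ e → Unique (colours (incidencePairs e))
    unique e = colours-unique (c-isCF _ _ (e≢ne e ∘ cong proj₁ , e , inj₁ refl , inj₂ refl))

    disjoint : ∀ e → Disjoint (colours (incidencePairs e)) (colours (incidencePairs (next e)))
    disjoint e = colours-disjoint
      (c-isCF _ _ (e≢ne e ∘ cong proj₁ , next e , inj₂ refl , inj₁ refl))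
      (c-isCF _ _ (e≢nne e ∘ cong proj₁ , next e , inj₂ refl , inj₂ refl))
      (c-isCF _ _ (e≢nne e ∘ cong proj₂ , next e , inj₁ refl , inj₁ refl))
      (c-isCF _ _ (e≢ne (next e) ∘ cong proj₁ , next e , inj₁ refl , inj₂ refl))

colourable⇒pairing : CFIncColorable (Cycle (suc (suc (suc m)))) k →
                     Σ (Fin (suc (suc (suc m))) → Fin k × Fin k) IsCyclicPairing
colourable⇒pairing (_ , c-isCF) = _ , incidencePairs-isCyclicPairing c-isCF

module _ {S : Fin (suc m) → Fin k × Fin k} (pairing : IsCyclicPairing S) where
  open IsCyclicPairing pairing

  pairing⇒4≤ : 4 ≤ k
  pairing⇒4≤ = unique⇒length≤ (++⁺ (unique Fin.zero) (unique (next Fin.zero)) (disjoint Fin.zero))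

module _ {S : Fin 3 → Fin k × Fin k} (pairing : IsCyclicPairing S) where
  open IsCyclicPairing pairing

  triangle-pairing⇒6≤ : 6 ≤ k
  triangle-pairing⇒6≤ = unique⇒length≤ (concat⁺
    (unique e₀ ∷ unique e₁ ∷ unique e₂ ∷ [])
    ((disjoint e₀ ∷ Disjoint-sym (disjoint e₂) ∷ []) ∷ (disjoint e₁ ∷ []) ∷ [] ∷ []))
    -- next e₂ computes to e₀
    where
    e₀ e₁ e₂ : Fin 3
    e₀ = Fin.zero
    e₁ = next e₀
    e₂ = next e₁

module _ {q : ℕ} {S : Fin (suc (q * 2)) → Fin 4 × Fin 4} (pairing : IsCyclicPairing S) where
  open IsCyclicPairing pairing

  consecutive-cover : ∀ e x → x ∈ colours (S e) ⊎ x ∈ colours (S (next e))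
  consecutive-cover e x =
    ∈-++⁻ (colours (S e)) (unique∧length≡⇒∈ (++⁺ (unique e) (unique (next e)) (disjoint e)) refl x)

  ∈-next² : ∀ {e x} → x ∈ colours (S e) → x ∈ colours (S (next (next e)))
  ∈-next² {e} {x} x∈e with consecutive-cover (next e) x
  ... | inj₁ x∈ne  = contradiction (x∈e , x∈ne) (disjoint e)
  ... | inj₂ x∈nne = x∈nne

  ∈-even-steps : ∀ {x} → x ∈ colours (S Fin.zero) → ∀ j → x ∈ colours (S (fold Fin.zero next (j * 2)))
  ∈-even-steps x∈ zero    = x∈
  ∈-even-steps x∈ (suc j) = ∈-next² (∈-even-steps x∈ j)

  odd-cycle-4-pairing⇒⊥ : ⊥
  odd-cycle-4-pairing⇒⊥ = disjoint (fold Fin.zero next (q * 2))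
    (∈-even-steps (here refl) q , subst (λ e → proj₁ (S Fin.zero) ∈ colours (S e)) (sym fold-next-period) (here refl))

sequence⇒pairing : (f : ℕ → Fin k × Fin k) →
  (∀ t → Unique (colours (f t))) →
  (∀ t → t < m → Disjoint (colours (f t)) (colours (f (suc t)))) →
  Disjoint (colours (f m)) (colours (f 0)) →
  IsCyclicPairing {m} (f ∘ toℕ)
sequence⇒pairing f unique step wrap = record { unique = unique ∘ toℕ ; disjoint = disjoint }
  where
  disjoint : ∀ e → Disjoint (colours (f (toℕ e))) (colours (f (toℕ (next e))))
  disjoint e with toℕ-next-cases e
  ... | inj₁ (e<m , ne≡1+e) rewrite ne≡1+e = step (toℕ e) e<m
  ... | inj₂ (e≡m , ne≡0)  rewrite ne≡0 | e≡m = wrap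

alternating : A → A → ℕ → A
alternating P Q zero          = P
alternating P Q (suc zero)    = Q
alternating P Q (suc (suc t)) = alternating P Q t

module _ {P Q : A} where

  alternating-all : (R : A → Set) → R P → R Q → ∀ t → R (alternating P Q t)
  alternating-all R RP RQ zero          = RP
  alternating-all R RP RQ (suc zero)    = RQ
  alternating-all R RP RQ (suc (suc t)) = alternating-all R RP RQ t

  alternating-consecutive : (R : A → A → Set) → R P Q → R Q P → ∀ t → R (alternating P Q t) (alternating P Q (suc t))
  alternating-consecutive R RPQ RQP zero          = RPQ
  alternating-consecutive R RPQ RQP (suc zero)    = RQP
  alternating-consecutive R RPQ RQP (suc (suc t)) = alternating-consecutive R RPQ RQP t

  alternating-odd : ∀ j → alternating P Q (suc (j * 2)) ≡ Q
  alternating-odd zero    = refl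
  alternating-odd (suc j) = alternating-odd j

even-cycle-pairing : ∀ j → Σ (Fin (suc (suc (j * 2))) → Fin 4 × Fin 4) IsCyclicPairing
even-cycle-pairing j = _ , sequence⇒pairing (alternating P Q)
  (alternating-all (Unique ∘ colours) (colours-unique (λ ())) (colours-unique (λ ())))
  (λ t _ → alternating-consecutive (λ X Y → Disjoint (colours X) (colours Y)) P#Q (Disjoint-sym P#Q) t)
  (subst (λ X → Disjoint (colours X) (colours P)) (sym (alternating-odd j)) (Disjoint-sym P#Q))
  where
  P Q : Fin 4 × Fin 4
  P = # 0 , # 1
  Q = # 2 , # 3
  P#Q : Disjoint (colours P) (colours Q)
  P#Q = colours-disjoint (λ ()) (λ ()) (λ ()) (λ ())

oddCyclePairs : ℕ → ℕ → Fin 5 × Fin 5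
oddCyclePairs zero    zero          = # 4 , # 0
oddCyclePairs zero    (suc zero)    = # 1 , # 2
oddCyclePairs zero    (suc (suc _)) = # 3 , # 4
oddCyclePairs (suc _) zero          = # 0 , # 1
oddCyclePairs (suc _) (suc zero)    = # 2 , # 3
oddCyclePairs (suc r) (suc (suc t)) = oddCyclePairs r t

oddCyclePairs-unique : ∀ r t → Unique (colours (oddCyclePairs r t))
oddCyclePairs-unique zero    zero          = colours-unique (λ ())
oddCyclePairs-unique zero    (suc zero)    = colours-unique (λ ())
oddCyclePairs-unique zero    (suc (suc _)) = colours-unique (λ ())
oddCyclePairs-unique (suc _) zero          = colours-unique (λ ())
oddCyclePairs-unique (suc _) (suc zero)    = colours-unique (λ ())
oddCyclePairs-unique (suc r) (suc (suc t)) = oddCyclePairs-unique r t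

oddCyclePairs-step : ∀ r t → t < suc (suc (r * 2)) →
  Disjoint (colours (oddCyclePairs r t)) (colours (oddCyclePairs r (suc t)))
oddCyclePairs-step zero          zero          _ = colours-disjoint (λ ()) (λ ()) (λ ()) (λ ())
oddCyclePairs-step zero          (suc zero)    _ = colours-disjoint (λ ()) (λ ()) (λ ()) (λ ())
oddCyclePairs-step zero          (suc (suc t)) (s≤s (s≤s ()))
oddCyclePairs-step (suc _)       zero          _ = colours-disjoint (λ ()) (λ ()) (λ ()) (λ ())
oddCyclePairs-step (suc zero)    (suc zero)    _ = colours-disjoint (λ ()) (λ ()) (λ ()) (λ ())
oddCyclePairs-step (suc (suc r)) (suc zero)    _ = colours-disjoint (λ ()) (λ ()) (λ ()) (λ ())
oddCyclePairs-step (suc r)       (suc (suc t)) (s≤s (s≤s t<)) = oddCyclePairs-step r t t<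

oddCyclePairs-last : ∀ r → oddCyclePairs r (suc (suc (r * 2))) ≡ (# 3 , # 4)
oddCyclePairs-last zero    = refl
oddCyclePairs-last (suc r) = oddCyclePairs-last r

odd-cycle-pairing : ∀ r → Σ (Fin (suc (suc (suc (suc r * 2)))) → Fin 5 × Fin 5) IsCyclicPairing
odd-cycle-pairing r = _ , sequence⇒pairing (oddCyclePairs (suc r))
  (oddCyclePairs-unique (suc r))
  (oddCyclePairs-step (suc r))
  (subst (λ X → Disjoint (colours X) (colours (# 0 , # 1))) (sym (oddCyclePairs-last (suc r)))
    (colours-disjoint (λ ()) (λ ()) (λ ()) (λ ())))

triangle-pairing : Σ (Fin 3 → Fin 6 × Fin 6) IsCyclicPairing
triangle-pairing = _ , sequence⇒pairing pairs
  (λ { zero → colours-unique (λ ()) ; (suc zero) → colours-unique (λ ()) ; (suc (suc _)) → colours-unique (λ ()) })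
  (λ { zero _ → colours-disjoint (λ ()) (λ ()) (λ ()) (λ ())
     ; (suc zero) _ → colours-disjoint (λ ()) (λ ()) (λ ()) (λ ())
     ; (suc (suc t)) (s≤s (s≤s ())) })
  (colours-disjoint (λ ()) (λ ()) (λ ()) (λ ()))
  where
  pairs : ℕ → Fin 6 × Fin 6
  pairs zero          = # 0 , # 1
  pairs (suc zero)    = # 2 , # 3
  pairs (suc (suc _)) = # 4 , # 5

¬2∣⇒odd : ∀ n → ¬ 2 ∣ n → ∃[ q ] n ≡ suc (q * 2)
¬2∣⇒odd zero          ¬2∣0   = contradiction (2 ∣0) ¬2∣0
¬2∣⇒odd (suc zero)    _      = 0 , refl
¬2∣⇒odd (suc (suc n)) ¬2∣2+n with ¬2∣⇒odd n (¬2∣2+n ∘ ∣m∣n⇒∣m+n ∣-refl)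
... | q , refl = suc q , refl

theorem2p5 : (∀ n → 3 ≤ n → 2 ∣ n → ChiIc≡ (Cycle n) 4)
    × (∀ n → 5 ≤ n → ¬ (2 ∣ n) → ChiIc≡ (Cycle n) 5)
    × ChiIc≡ (Cycle 3) 6
theorem2p5 = even , odd , triangle
  where
  even : ∀ n → 3 ≤ n → 2 ∣ n → ChiIc≡ (Cycle n) 4
  even _ ()                   (divides zero refl)
  even _ (s≤s (s≤s ()))       (divides (suc zero) refl)
  even _ _                    (divides (suc (suc j)) refl) =
    pairing⇒colourable (proj₂ (even-cycle-pairing (suc j))) ,
    λ _ → pairing⇒4≤ ∘ proj₂ ∘ colourable⇒pairing

  odd : ∀ n → 5 ≤ n → ¬ (2 ∣ n) → ChiIc≡ (Cycle n) 5
  odd n 5≤n ¬2∣n with ¬2∣⇒odd n ¬2∣n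
  ... | zero        , refl = contradiction 5≤n λ { (s≤s ()) }
  ... | suc zero    , refl = contradiction 5≤n λ { (s≤s (s≤s (s≤s ()))) }
  ... | suc (suc r) , refl = pairing⇒colourable (proj₂ (odd-cycle-pairing r)) , at-least-5
    where
    at-least-5 : ∀ k → CFIncColorable (Cycle (suc (suc (suc r) * 2))) k → 5 ≤ k
    at-least-5 k colourable = ≤∧≢⇒< (pairing⇒4≤ pairing)
      λ { refl → odd-cycle-4-pairing⇒⊥ {q = suc (suc r)} pairing }
      where
      pairing : IsCyclicPairing (proj₁ (colourable⇒pairing colourable))
      pairing = proj₂ (colourable⇒pairing colourable)

  triangle : ChiIc≡ (Cycle 3) 6
  triangle = pairing⇒colourable (proj₂ triangle-pairing) ,
             λ _ → triangle-pairing⇒6≤ ∘ proj₂ ∘ colourable⇒pairing
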